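{- For every $n\ge1$, $2w_n\in C(2q_n)$ and $2r_n\in C(2q_n)$, where $w_n=x_1\cdots x_n(x_1^2+1)$, $q_n=x_1^3x_2\cdots x_n$ and $r_n=x_1\cdots x_n$.
   Context: Arithmetic is in $\mathbb{Z}_8$. For an operation $g$, $C(g)$ denotes the clone on $\mathbb{Z}_8$ generated by $g$, the binary addition and all unary constant operations. -}

module Defs where

open import Data.Nat as ℕ using (ℕ; zero; suc)
open import Data.Nat.DivMod using (_mod_)
open import Data.Fin using (Fin; zero; suc; toℕ)
open import Data.Product using (Σ)
open import Relation.Binary.PropositionalEquality using (_≡_)

Z8 : Set
Z8 = Fin 8

infixl 6 _⊕_
infixl 7 _⊗_

_⊕_ : Z8 → Z8 → Z8
a ⊕ b = (toℕ a ℕ.+ toℕ b) mod 8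

_⊗_ : Z8 → Z8 → Z8
a ⊗ b = (toℕ a ℕ.* toℕ b) mod 8

num : ℕ → Z8
num n = n mod 8

Op : ℕ → Set
Op k = (Fin k → Z8) → Z8

prodAll : ∀ {n} → (Fin n → Z8) → Z8
prodAll {zero} _ = num 1
prodAll {suc n} x = x zero ⊗ prodAll (λ i → x (suc i))

data Term (m k : ℕ) : Set where
  var : Fin k → Term m k
  cst : Z8 → Term m k
  add : Term m k → Term m k → Term m k
  gen : (Fin m → Term m k) → Term m k

eval : ∀ {m k} → Op m → Term m k → Op k
eval g (var i) x = x i
eval g (cst c) x = c
eval g (add s t) x = eval g s x ⊕ eval g t x
eval g (gen ts) x = g (λ j → eval g (ts j) x)

-- f ∈ C(g): f is a term operation of the algebra (ℤ_8; g, +, constants),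
-- i.e. belongs to the clone generated by g, + and all unary constants.
_∈C_ : ∀ {m k} → Op k → Op m → Set
_∈C_ {m} {k} f g = Σ (Term m k) (λ t → ∀ x → eval g t x ≡ f x)

-- x_1 is index zero.
-- q_n = x_1^3 x_2 ⋯ x_n
q : ∀ n → Op (suc n)
q n x = x zero ⊗ x zero ⊗ prodAll x

r : ∀ n → Op (suc n)
r n x = prodAll x

w : ∀ n → Op (suc n)
w n x = prodAll x ⊗ (x zero ⊗ x zero ⊕ num 1)

twice : ∀ {k} → Op k → Op k
twice f x = num 2 ⊗ f x

-- Since w = q + r pointwise, 2w_n ∈ C(2q_n) follows from 2r_n ∈ C(2q_n) by closure under +.
-- For n = 1, 2r_1 = x₁ + x₁. For n ≥ 2, 2q_n(s, t, x₃, …, xₙ) = 2s³t·x₃⋯xₙ, and 2ab is a sum of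
-- three values 2s³t with s, t affine in a and b; substituting x₁, x₂ for a, b gives a term for 2r_n.
-- (The Agda index n is the paper's n − 1.)
module Submission where

open import Defs
open import Data.Nat using (ℕ; zero; suc)
open import Data.Fin using (zero; suc)
open import Data.Fin.Properties using (all?; _≟_)
open import Data.Product using (_×_; _,_)
open import Data.Vec.Functional using (_∷_)
open import Relation.Binary.PropositionalEquality using (_≡_; _≗_; refl; sym; trans; cong₂)
open import Relation.Nullary.Decidable using (toWitness)

∈C-gen : ∀ {m} {g : Op m} → g ∈C g
∈C-gen = gen var , λ _ → refl

module _ {m k : ℕ} {g : Op m} where

  ∈C-resp-≗ : {f h : Op k} → f ≗ h → f ∈C g → h ∈C g
  ∈C-resp-≗ f≗h (t , t≗f) = t , λ x → trans (t≗f x) (f≗h x)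

  ∈C-⊕ : {f h : Op k} → f ∈C g → h ∈C g → (λ x → f x ⊕ h x) ∈C g
  ∈C-⊕ (s , s≗f) (t , t≗h) = add s t , λ x → cong₂ _⊕_ (s≗f x) (t≗h x)

twice-q⊕twice-r≗twice-w : ∀ n → (λ x → twice (q n) x ⊕ twice (r n) x) ≗ twice (w n)
twice-q⊕twice-r≗twice-w n x = distrib (x zero) (prodAll x)
  where
  distrib : ∀ a p → num 2 ⊗ (a ⊗ a ⊗ p) ⊕ num 2 ⊗ p ≡ num 2 ⊗ (p ⊗ (a ⊗ a ⊕ num 1))
  distrib = toWitness {a? = all? λ _ → all? λ _ → _ ≟ _} _

-- In ℤ₈, 2s³ = 2s + 4·[s ≡ 2 mod 4]. The parts 2st of the three summands add up to
-- 2ab + 4a(a+1) + 4b(b+1) = 2ab, and the corrections 4t·[s ≡ 2 mod 4] cancel by a parity count.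
twice-product≡sum-of-cubes : ∀ a b c →
  num 2 ⊗ (a ⊗ (b ⊗ c))
    ≡ num 2 ⊗ (b ⊗ b ⊗ (b ⊗ ((a ⊕ num 1) ⊗ c)))
    ⊕ num 2 ⊗ (a ⊗ a ⊗ (a ⊗ ((a ⊕ b ⊕ num 1) ⊗ c)))
    ⊕ num 2 ⊗ ((a ⊕ b) ⊗ (a ⊕ b) ⊗ ((a ⊕ b) ⊗ ((a ⊕ b ⊕ b ⊕ num 1) ⊗ c)))
twice-product≡sum-of-cubes = toWitness {a? = all? λ _ → all? λ _ → all? λ _ → _ ≟ _} _

gen-with-first-two : ∀ {k} → (s t : Term (suc (suc k)) (suc (suc k))) → Term (suc (suc k)) (suc (suc k))
gen-with-first-two s t = gen (s ∷ t ∷ λ i → var (suc (suc i)))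

twice-r∈C-twice-q : ∀ n → twice (r n) ∈C twice (q n)
twice-r∈C-twice-q zero = add (var zero) (var zero) , λ x → double≡twice (x zero)
  where
  double≡twice : ∀ a → a ⊕ a ≡ num 2 ⊗ (a ⊗ num 1)
  double≡twice = toWitness {a? = all? λ _ → _ ≟ _} _
twice-r∈C-twice-q (suc k) = term , λ x →
  sym (twice-product≡sum-of-cubes (x zero) (x (suc zero)) (prodAll λ i → x (suc (suc i))))
  where
  infixl 6 _+ₜ_
  _+ₜ_ : (s t : Term (suc (suc k)) (suc (suc k))) → Term (suc (suc k)) (suc (suc k))
  _+ₜ_ = add
  x₁ x₂ one : Term (suc (suc k)) (suc (suc k))
  x₁ = var zero
  x₂ = var (suc zero)
  one = cst (num 1)
  term : Term (suc (suc k)) (suc (suc k))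
  term = gen-with-first-two x₂ (x₁ +ₜ one)
      +ₜ gen-with-first-two x₁ (x₁ +ₜ x₂ +ₜ one)
      +ₜ gen-with-first-two (x₁ +ₜ x₂) (x₁ +ₜ x₂ +ₜ x₂ +ₜ one)

lemma4p6 : ∀ n → (twice (w n) ∈C twice (q n)) × (twice (r n) ∈C twice (q n))
lemma4p6 n =
    ∈C-resp-≗ (twice-q⊕twice-r≗twice-w n) (∈C-⊕ ∈C-gen (twice-r∈C-twice-q n))
  , twice-r∈C-twice-q n
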